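{- Let $\mathcal{C}$ be a $\overline{3}$-SC$(3,M,q)$. Then for any $\mathcal{C}_0\subseteq\mathcal{C}$ with $|\mathcal{C}_0|\le 3$, any $\mathbf{c}\in\mathcal{C}_0$, and any $\mathbf{c}'\in(\mathsf{desc}(\mathcal{C}_0)\cap\mathcal{C})\setminus\mathcal{C}_0$, the Hamming distance satisfies $d(\mathbf{c},\mathbf{c}')\ge 2$.
   Context: An $(n,M,q)$ code is a set $\mathcal{C}\subseteq Q^n$ of $M$ distinct words (codewords), where $|Q|=q$. For $\mathcal{C}_0\subseteq\mathcal{C}$ and $1\le i\le n$, let $\mathcal{C}_0(i)=\{\mathbf{c}(i):\mathbf{c}\in\mathcal{C}_0\}$, and $\mathsf{desc}(\mathcal{C}_0)=\mathcal{C}_0(1)\times\cdots\times\mathcal{C}_0(n)$. $\mathcal{C}$ is a $\overline{t}$-SC$(n,M,q)$ ($\overline{t}$-separable code) if for any distinct $\mathcal{C}_1,\mathcal{C}_2\subseteq\mathcal{C}$ with $1\le|\mathcal{C}_1|,|\mathcal{C}_2|\le t$, $\mathsf{desc}(\mathcal{C}_1)\ne\mathsf{desc}(\mathcal{C}_2)$. The Hamming distance $d(\mathbf{x},\mathbf{y})$ is the number of coordinates in which $\mathbf{x}$ and $\mathbf{y}$ differ. -}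

module Defs where

open import Data.Nat using (ℕ; _≤_; _+_)
open import Data.Fin using (Fin)
open import Data.Fin.Subset using (Subset; _∈_; ∣_∣)
open import Data.Vec using (Vec; lookup)
open import Data.Product using (Σ; _×_; ∃-syntax)
open import Data.List using (List; length; filter; allFin)
open import Data.Fin using (_≟_)
open import Relation.Binary.PropositionalEquality using (_≡_; _≢_)
open import Relation.Nullary using (¬_; ¬?)
open import Function.Definitions using (Injective)

Word : ℕ → ℕ → Set
Word n q = Vec (Fin q) n

record Code (n M q : ℕ) : Set where
  field
    word     : Fin M → Word n q
    distinct : Injective _≡_ _≡_ word
open Code public

-- Subcodes C₀ ⊆ C are subsets of the index set Fin M (so |C₀| = ∣ C₀ ∣).
-- x ∈ desc(C₀) = C₀(1) × ⋯ × C₀(n): every coordinate of x is the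
-- corresponding coordinate of some codeword of C₀.
desc∈ : ∀ {n M q} (C : Code n M q) → Word n q → Subset M → Set
desc∈ {n} C x C₀ =
  (i : Fin n) → ∃[ j ] (j ∈ C₀ × lookup (word C j) i ≡ lookup x i)

SameDesc : ∀ {n M q} (C : Code n M q) → Subset M → Subset M → Set
SameDesc {n} {M} {q} C C₁ C₂ =
  (x : Word n q) → (desc∈ C x C₁ → desc∈ C x C₂) × (desc∈ C x C₂ → desc∈ C x C₁)

IsSeparable : ∀ {n M q} → ℕ → Code n M q → Set
IsSeparable {n} {M} {q} t C =
  (C₁ C₂ : Subset M) → C₁ ≢ C₂ →
  1 ≤ ∣ C₁ ∣ → ∣ C₁ ∣ ≤ t → 1 ≤ ∣ C₂ ∣ → ∣ C₂ ∣ ≤ t →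
  ¬ SameDesc C C₁ C₂

hamming : ∀ {n q} → Word n q → Word n q → ℕ
hamming {n} x y = length (filter (λ i → ¬? (lookup x i ≟ lookup y i)) (allFin n))

-- If c and c' are at distance at most 1, then c' is a descendant of the pair
-- {c, a}, where a ∈ C₀ supplies c' at the one coordinate where c' may differ
-- from c. Adding the descendant c' to {c, a} does not change desc, so the
-- subcodes {c, a} and {c, a, c'} of size at most 3 would violate separability.
module Submission where

open import Defs
open import Data.Nat using (ℕ; _≤_; _+_; suc; s≤s; z≤n)
open import Data.Nat.Properties using (≤-trans; ≤-reflexive; +-monoʳ-≤; +-suc; n≤1+n; ≰⇒>)
open import Data.Fin using (Fin; _≟_)
open import Data.Fin.Properties using (any?)
open import Data.Fin.Subset using (Subset; _∈_; _∉_; ∣_∣; _∪_; ⁅_⁆; inside; outside)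
open import Data.Fin.Subset.Properties
  using (x∈⁅x⁆; x∈⁅y⁆⇒x≡y; ∣⁅x⁆∣≡1; x∈p∪q⁺; x∈p∪q⁻; ∣p∣≤∣p∪q∣; ∣p∣≤∣x∷p∣)
open import Data.Vec using (_∷_; []; lookup)
open import Data.List using (List; []; _∷_; length; filter; allFin)
open import Data.List.Membership.Propositional using () renaming (_∈_ to _∈ₗ_)
open import Data.List.Membership.Propositional.Properties using (∈-filter⁺; ∈-allFin)
open import Data.List.Relation.Unary.Any using (here)
open import Data.Product using (_×_; _,_; ∃-syntax)
open import Data.Sum using (inj₁; inj₂)
open import Data.Empty using (⊥-elim)
open import Relation.Nullary using (¬_; ¬?; yes; no)
open import Relation.Binary.PropositionalEquality
  using (_≡_; _≢_; refl; sym; trans; cong; subst)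

∣p∪q∣≤∣p∣+∣q∣ : ∀ {m} (p q : Subset m) → ∣ p ∪ q ∣ ≤ ∣ p ∣ + ∣ q ∣
∣p∪q∣≤∣p∣+∣q∣ []            []            = z≤n
∣p∪q∣≤∣p∣+∣q∣ (inside ∷ p)  (s ∷ q)       =
  s≤s (≤-trans (∣p∪q∣≤∣p∣+∣q∣ p q) (+-monoʳ-≤ ∣ p ∣ (∣p∣≤∣x∷p∣ s q)))
∣p∪q∣≤∣p∣+∣q∣ (outside ∷ p) (inside ∷ q)  =
  ≤-trans (s≤s (∣p∪q∣≤∣p∣+∣q∣ p q)) (≤-reflexive (sym (+-suc ∣ p ∣ ∣ q ∣)))
∣p∪q∣≤∣p∣+∣q∣ (outside ∷ p) (outside ∷ q) = ∣p∪q∣≤∣p∣+∣q∣ p q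

∣⁅x⁆∪p∣≤1+∣p∣ : ∀ {m} (x : Fin m) (p : Subset m) → ∣ ⁅ x ⁆ ∪ p ∣ ≤ suc ∣ p ∣
∣⁅x⁆∪p∣≤1+∣p∣ x p = ≤-trans (∣p∪q∣≤∣p∣+∣q∣ ⁅ x ⁆ p) (≤-reflexive (cong (_+ ∣ p ∣) (∣⁅x⁆∣≡1 x)))

1≤∣⁅x⁆∪p∣ : ∀ {m} (x : Fin m) (p : Subset m) → 1 ≤ ∣ ⁅ x ⁆ ∪ p ∣
1≤∣⁅x⁆∪p∣ x p = ≤-trans (≤-reflexive (sym (∣⁅x⁆∣≡1 x))) (∣p∣≤∣p∪q∣ ⁅ x ⁆ p)

length≤1⇒∈-unique : ∀ {A : Set} {xs : List A} {x y : A} →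
  length xs ≤ 1 → x ∈ₗ xs → y ∈ₗ xs → x ≡ y
length≤1⇒∈-unique {xs = _ ∷ []}    _         (here x≡z) (here y≡z) = trans x≡z (sym y≡z)
length≤1⇒∈-unique {xs = _ ∷ _ ∷ _} (s≤s ())  _          _

hamming≤1⇒difference-unique : ∀ {n q} (x y : Word n q) {i i′ : Fin n} → hamming x y ≤ 1 →
  lookup x i ≢ lookup y i → lookup x i′ ≢ lookup y i′ → i ≡ i′
hamming≤1⇒difference-unique x y {i} {i′} close xᵢ≢yᵢ xᵢ′≢yᵢ′ =
  length≤1⇒∈-unique close (differs i xᵢ≢yᵢ) (differs i′ xᵢ′≢yᵢ′)
  where
  differs : ∀ l → lookup x l ≢ lookup y l → l ∈ₗ filter (λ l → ¬? (lookup x l ≟ lookup y l)) (allFin _)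
  differs l = ∈-filter⁺ (λ l → ¬? (lookup x l ≟ lookup y l)) (∈-allFin l)

module _ {n M q : ℕ} (C : Code n M q) where

  desc∈⇒SameDesc-⁅x⁆∪ : ∀ {k} {C₁ : Subset M} → desc∈ C (word C k) C₁ →
    SameDesc C C₁ (⁅ k ⁆ ∪ C₁)
  desc∈⇒SameDesc-⁅x⁆∪ {k} {C₁} k∈desc x = widen , narrow
    where
    widen : desc∈ C x C₁ → desc∈ C x (⁅ k ⁆ ∪ C₁)
    widen x∈desc i with x∈desc i
    ... | b , b∈C₁ , bᵢ≡xᵢ = b , x∈p∪q⁺ (inj₂ b∈C₁) , bᵢ≡xᵢ

    narrow : desc∈ C x (⁅ k ⁆ ∪ C₁) → desc∈ C x C₁
    narrow x∈desc i with x∈desc i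
    ... | b , b∈ , bᵢ≡xᵢ with x∈p∪q⁻ ⁅ k ⁆ C₁ b∈
    ... | inj₂ b∈C₁ = b , b∈C₁ , bᵢ≡xᵢ
    ... | inj₁ b∈⁅k⁆ with x∈⁅y⁆⇒x≡y k b∈⁅k⁆
    ... | refl with k∈desc i
    ... | a , a∈C₁ , aᵢ≡kᵢ = a , a∈C₁ , trans aᵢ≡kᵢ bᵢ≡xᵢ

  separable⇒¬desc∈ : ∀ {t} → IsSeparable t C → {C₁ : Subset M} →
    1 ≤ ∣ C₁ ∣ → suc ∣ C₁ ∣ ≤ t → ∀ {k} → k ∉ C₁ → ¬ desc∈ C (word C k) C₁
  separable⇒¬desc∈ sep {C₁} 1≤∣C₁∣ ∣C₁∣<t {k} k∉C₁ k∈desc =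
    sep C₁ (⁅ k ⁆ ∪ C₁) C₁≢ 1≤∣C₁∣ (≤-trans (n≤1+n _) ∣C₁∣<t)
        (1≤∣⁅x⁆∪p∣ k C₁) (≤-trans (∣⁅x⁆∪p∣≤1+∣p∣ k C₁) ∣C₁∣<t)
        (desc∈⇒SameDesc-⁅x⁆∪ k∈desc)
    where
    C₁≢ : C₁ ≢ ⁅ k ⁆ ∪ C₁
    C₁≢ C₁≡ = k∉C₁ (subst (k ∈_) (sym C₁≡) (x∈p∪q⁺ (inj₁ (x∈⁅x⁆ k))))

  desc∈-pair : ∀ {j a k} → (∀ i → lookup (word C j) i ≢ lookup (word C k) i →
    lookup (word C a) i ≡ lookup (word C k) i) → desc∈ C (word C k) (⁅ j ⁆ ∪ ⁅ a ⁆)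
  desc∈-pair {j} {a} {k} a-covers i with lookup (word C j) i ≟ lookup (word C k) i
  ... | yes jᵢ≡kᵢ = j , x∈p∪q⁺ (inj₁ (x∈⁅x⁆ j)) , jᵢ≡kᵢ
  ... | no  jᵢ≢kᵢ = a , x∈p∪q⁺ (inj₂ (x∈⁅x⁆ a)) , a-covers i jᵢ≢kᵢ

  hamming≤1⇒desc∈-pair : ∀ {C₀ j k} → hamming (word C j) (word C k) ≤ 1 → j ∈ C₀ →
    desc∈ C (word C k) C₀ → ∃[ a ] (a ∈ C₀ × desc∈ C (word C k) (⁅ j ⁆ ∪ ⁅ a ⁆))
  hamming≤1⇒desc∈-pair {C₀} {j} {k} close j∈C₀ k∈desc
    with any? (λ i → ¬? (lookup (word C j) i ≟ lookup (word C k) i))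
  ... | no ¬difference = j , j∈C₀ , desc∈-pair λ i jᵢ≢kᵢ → ⊥-elim (¬difference (i , jᵢ≢kᵢ))
  ... | yes (i , jᵢ≢kᵢ) with k∈desc i
  ... | a , a∈C₀ , aᵢ≡kᵢ = a , a∈C₀ , desc∈-pair a-covers
    where
    a-covers : ∀ i′ → lookup (word C j) i′ ≢ lookup (word C k) i′ →
      lookup (word C a) i′ ≡ lookup (word C k) i′
    a-covers i′ jᵢ′≢kᵢ′ with hamming≤1⇒difference-unique (word C j) (word C k) close jᵢ≢kᵢ jᵢ′≢kᵢ′
    ... | refl = aᵢ≡kᵢ

lemma5 : ∀ {M q} (C : Code 3 M q) → IsSeparable 3 C →
    (C₀ : Subset M) → ∣ C₀ ∣ ≤ 3 →
    (j : Fin M) → j ∈ C₀ →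
    (k : Fin M) → desc∈ C (word C k) C₀ → k ∉ C₀ →
    2 ≤ hamming (word C j) (word C k)
lemma5 C sep C₀ _ j j∈C₀ k k∈desc k∉C₀ = ≰⇒> ¬close
  where
  ¬close : ¬ hamming (word C j) (word C k) ≤ 1
  ¬close close with hamming≤1⇒desc∈-pair C close j∈C₀ k∈desc
  ... | a , a∈C₀ , k∈desc-pair =
    separable⇒¬desc∈ C sep (1≤∣⁅x⁆∪p∣ j ⁅ a ⁆) ∣pair∣<3 k∉pair k∈desc-pair
    where
    ∣pair∣<3 : suc ∣ ⁅ j ⁆ ∪ ⁅ a ⁆ ∣ ≤ 3
    ∣pair∣<3 = s≤s (≤-trans (∣⁅x⁆∪p∣≤1+∣p∣ j ⁅ a ⁆) (≤-reflexive (cong suc (∣⁅x⁆∣≡1 a))))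

    k∉pair : k ∉ ⁅ j ⁆ ∪ ⁅ a ⁆
    k∉pair k∈ with x∈p∪q⁻ ⁅ j ⁆ ⁅ a ⁆ k∈
    ... | inj₁ k∈⁅j⁆ = k∉C₀ (subst (_∈ C₀) (sym (x∈⁅y⁆⇒x≡y j k∈⁅j⁆)) j∈C₀)
    ... | inj₂ k∈⁅a⁆ = k∉C₀ (subst (_∈ C₀) (sym (x∈⁅y⁆⇒x≡y a k∈⁅a⁆)) a∈C₀)
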